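{- Let $k$ be an integer with $k > 2$. For any finite word $w$, let $N_k(w)$ denote the number of distinct non-empty factors of $w$ of the form $\underbrace{uu\cdots u}_{k\text{ times}}$ (with $u$ a word), let $|w|$ denote the length of $w$, and let $|\mathrm{Alph}(w)|$ denote the number of distinct letters occurring in $w$. Then $$N_k(w) \leq \frac{|w| - |\mathrm{Alph}(w)|}{k-2}.$$
   Context: A word is a finite sequence of letters $w = w_1 w_2\cdots w_n$; its length is $|w|=n$, and $\mathrm{Alph}(w)=\{w_i : 1\le i\le n\}$. A word $u$ is a factor of $w$ if $w = pus$ for some (possibly empty) words $p,s$. -}

module Defs where

open import Data.Nat using (ℕ)
open import Data.List using (List; []; _++_; concat; replicate)
open import Data.List.Membership.Propositional using (_∈_)
open import Data.List.Relation.Unary.Unique.Propositional using (Unique)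
open import Data.Product using (∃; ∃₂; _×_)
open import Function.Bundles using (_⇔_)
open import Relation.Binary.PropositionalEquality using (_≡_)
open import Relation.Nullary using (¬_)

_^ʷ_ : {A : Set} → List A → ℕ → List A
u ^ʷ k = concat (replicate k u)

Factor : {A : Set} → List A → List A → Set
Factor u w = ∃₂ λ p s → w ≡ p ++ u ++ s

NonEmptyPowerFactor : {A : Set} → ℕ → List A → List A → Set
NonEmptyPowerFactor k w v = Factor v w × ¬ (v ≡ []) × ∃ (λ u → v ≡ u ^ʷ k)

-- L is a finite enumeration, without repetition, of exactly the elements
-- satisfying P; then  length L  is the cardinality of {x | P x}.
Enumerates : {X : Set} → List X → (X → Set) → Set
Enumerates {X} L P = Unique L × ((x : X) → (x ∈ L ⇔ P x))

InAlph : {A : Set} → List A → A → Set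
InAlph w a = a ∈ w

{-# OPTIONS --safe #-}

-- Write a factor u^k of w (k ≥ 3) as a power of the primitive root p of its period, so that
-- |u| = (m + 1)|p| and u^k = p^((m+1)k).  Its k − 2 images are the last positions of the
-- leftmost occurrences in w of p^j for j = mk + 3, …, (m + 1)k.  By the Fine–Wilf theorem two
-- leftmost powers of exponent at least 3 that end at the same position have the same length,
-- and then the same primitive root and exponent; so distinct pairs (factor, exponent) have
-- distinct images.  An image carries the same letter as the position |p| before it, so it is not
-- the first occurrence of a letter, and the |Alph(w)| first occurrences are further distinct
-- positions: (k − 2) N_k(w) + |Alph(w)| ≤ |w|.
module Submission where

open import Data.Empty using (⊥; ⊥-elim)
open import Data.Fin using (Fin; zero; suc; toℕ; fromℕ<)
open import Data.Fin.Properties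
  using (toℕ<n; toℕ-injective; toℕ-fromℕ<; injective⇒≤; +↔⊎; *↔×) renaming (_≟_ to _≟ᶠ_)
open import Data.List using (List; []; _∷_; _++_; length; lookup)
open import Data.List.Properties using (length-++; length-++-≤ˡ; ++-assoc; ++-identityʳ)
open import Data.List.Membership.Propositional using (_∈_)
open import Data.List.Membership.Propositional.Properties using (∈-lookup)
import Data.List.Relation.Unary.All as All
open import Data.List.Relation.Unary.AllPairs using (_∷_)
open import Data.List.Relation.Unary.Any using (here; there; index)
open import Data.List.Relation.Unary.Any.Properties using (lookup-index)
open import Data.List.Relation.Unary.Unique.Propositional using (Unique)
open import Data.Maybe using (Maybe; just; nothing)
open import Data.Maybe.Properties using (just-injective)
open import Data.Nat using (ℕ; zero; suc; pred; _+_; _*_; _∸_; _≤_; _<_; z≤n; s≤s; s≤s⁻¹; >-nonZero)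
open import Data.Nat.DivMod using (_%_; _/_; m≡m%n+[m/n]*n; m%n<n; m%n≤m; [m+kn]%n≡m%n; m<n⇒m%n≡m)
open import Data.Nat.Divisibility using (_∣_; divides; _∣?_; ∣-refl; ∣-trans; ∣⇒≤; n∣m*n; ∣m+n∣m⇒∣n; ∣m∣n⇒∣m+n)
open import Data.Nat.Induction using (<-wellFounded)
open import Data.Nat.Properties
open import Algebra.Properties.CommutativeSemigroup +-commutativeSemigroup
  using (x∙yz≈y∙xz; x∙yz≈xz∙y; xy∙z≈xz∙y; xy∙z≈y∙zx; xy∙z≈zx∙y)
open import Data.Product using (∃; ∃₂; _×_; _,_; proj₁; proj₂; uncurry)
open import Data.Sum using (_⊎_; inj₁; inj₂; [_,_]′)
open import Data.Sum.Function.Propositional using (_⊎-↔_)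
open import Function.Bundles using (Equivalence; Injection; _↣_)
open import Function.Construct.Composition using (_↔-∘_)
open import Function.Construct.Identity using (↔-id)
open import Function.Properties.Inverse using (↔⇒↣)
open import Induction.WellFounded using (Acc; acc)
open import Relation.Binary.Definitions using (tri<; tri≈; tri>)
open import Relation.Binary.PropositionalEquality
open import Relation.Nullary using (¬_; Dec; yes; no; contradiction)
open import Relation.Nullary.Decidable using (map′; _×-dec_; _→-dec_)

open import Defs

split-< : ∀ {m n} → m < n → ∃ λ d → 1 ≤ d × n ≡ m + d
split-< {m} {n} m<n = n ∸ m , m<n⇒0<n∸m m<n , sym (m+[n∸m]≡n (<⇒≤ m<n))

division-unique : ∀ {d r r′ q q′} → r < d → r′ < d → r + q * d ≡ r′ + q′ * d → r ≡ r′ × q ≡ q′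
division-unique {suc d} {r} {r′} {q} {q′} r<d r′<d eq = r≡r′ , *-cancelʳ-≡ q q′ (suc d) (+-cancelˡ-≡ r _ _ eq′)
  where
    r≡r′ : r ≡ r′
    r≡r′ = begin
      r                      ≡⟨ sym (m<n⇒m%n≡m r<d) ⟩
      r % suc d              ≡⟨ sym ([m+kn]%n≡m%n r q (suc d)) ⟩
      (r + q * suc d) % suc d   ≡⟨ cong (_% suc d) eq ⟩
      (r′ + q′ * suc d) % suc d ≡⟨ [m+kn]%n≡m%n r′ q′ (suc d) ⟩
      r′ % suc d             ≡⟨ m<n⇒m%n≡m r′<d ⟩
      r′                     ∎
      where open ≡-Reasoning
    eq′ : r + q * suc d ≡ r + q′ * suc d
    eq′ = trans eq (cong (_+ q′ * suc d) (sym r≡r′))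

two-roots-fit : ∀ {q q′ L d} → 3 * q ≤ L → 3 * q′ ≤ L + d → d < q′ → q + q′ ≤ L
two-roots-fit {q} {q′} {L} {d} 3q≤L 3q′≤L+d d<q′ with ≤-total q q′
... | inj₂ q′≤q = ≤-trans (+-monoʳ-≤ q (≤-trans q′≤q (m≤m+n q (q + 0)))) 3q≤L
... | inj₁ q≤q′ = ≤-trans (+-monoˡ-≤ q′ q≤q′) (<⇒≤ 2q′<L)
  where
    2q′<L : q′ + q′ < L
    2q′<L = +-cancelʳ-< q′ (q′ + q′) L
              (subst (_< L + q′) (trans (sym (+-assoc q′ q′ (q′ + 0))) (cong (q′ + q′ +_) (+-identityʳ q′)))
                (≤-<-trans 3q′≤L+d (+-monoʳ-< L d<q′)))

module _ {P : ℕ → Set} (P? : ∀ n → Dec (P n)) where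

  least-below : ∀ b → (∃ λ n → n < b × P n) → ∃ λ m → m < b × P m × (∀ {m′} → m′ < m → ¬ P m′)
  least-below (suc b) (n , n<1+b , Pn) with anyUpTo? P? b
  ... | yes below with m , m<b , Pm , minimal ← least-below b below = m , m≤n⇒m≤1+n m<b , Pm , minimal
  ... | no none = n , n<1+b , Pn , λ m′<n Pm′ → none (_ , <-≤-trans m′<n (s≤s⁻¹ n<1+b) , Pm′)

  least : ∀ {n} → P n → ∃ λ m → m ≤ n × P m × (∀ {m′} → m′ < m → ¬ P m′)
  least {n} Pn with m , m<1+n , Pm , minimal ← least-below (suc n) (n , ≤-refl , Pn) = m , s≤s⁻¹ m<1+n , Pm , minimal

-- Periods of sequences

module _ {X : Set} where

  infixl 6 _↓_
  _↓_ : (ℕ → X) → ℕ → ℕ → X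
  (u ↓ a) t = u (a + t)

  record HasPeriod (u : ℕ → X) (L p : ℕ) : Set where
    constructor periodic
    field step : ∀ t → t + p < L → u t ≡ u (t + p)

  record Agree (u v : ℕ → X) (L : ℕ) : Set where
    constructor agreeing
    field pointwise : ∀ t → t < L → u t ≡ v t

  agree-refl : ∀ {u L} → Agree u u L
  agree-refl = agreeing λ _ _ → refl

  agree-sym : ∀ {u v L} → Agree u v L → Agree v u L
  agree-sym (agreeing uv) = agreeing λ t t<L → sym (uv t t<L)

  agree-trans : ∀ {u v w L} → Agree u v L → Agree v w L → Agree u w L
  agree-trans (agreeing uv) (agreeing vw) = agreeing λ t t<L → trans (uv t t<L) (vw t t<L)

  agree-prefix : ∀ {u v L M} → M ≤ L → Agree u v L → Agree u v M
  agree-prefix M≤L (agreeing uv) = agreeing λ t t<M → uv t (<-≤-trans t<M M≤L)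

  ↓-↓ : ∀ u a b L → Agree (u ↓ a ↓ b) (u ↓ (a + b)) L
  ↓-↓ u a b L = agreeing λ t _ → cong u (sym (+-assoc a b t))

  period-prefix : ∀ {u L M p} → M ≤ L → HasPeriod u L p → HasPeriod u M p
  period-prefix M≤L (periodic per) = periodic λ t lt → per t (<-≤-trans lt M≤L)

  period-↓ : ∀ {u L p} a {M} → a + M ≤ L → HasPeriod u L p → HasPeriod (u ↓ a) M p
  period-↓ {u} {L} {p} a {M} a+M≤L (periodic per) = periodic λ t t+p<M → begin
    u (a + t)       ≡⟨ per (a + t) (<-≤-trans (subst (_< a + M) (sym (+-assoc a t p)) (+-monoʳ-< a t+p<M)) a+M≤L) ⟩
    u (a + t + p)   ≡⟨ cong u (+-assoc a t p) ⟩
    u (a + (t + p)) ∎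
    where open ≡-Reasoning

  period-transport : ∀ {u v L p} → Agree u v L → HasPeriod u L p → HasPeriod v L p
  period-transport {p = p} (agreeing uv) (periodic per) = periodic λ t lt →
    trans (sym (uv t (≤-<-trans (m≤m+n t p) lt))) (trans (per t lt) (uv (t + p) lt))

  period-multiple : ∀ {u L p} → HasPeriod u L p → ∀ i t → t + i * p < L → u t ≡ u (t + i * p)
  period-multiple {u} {L} {p} _ zero t _ = cong u (sym (+-identityʳ t))
  period-multiple {u} {L} {p} per (suc i) t lt = begin
    u t                 ≡⟨ HasPeriod.step per t (≤-<-trans (+-monoʳ-≤ t (m≤m+n p (i * p))) lt) ⟩
    u (t + p)           ≡⟨ period-multiple per i (t + p) (subst (_< L) (sym (+-assoc t p (i * p))) lt) ⟩
    u (t + p + i * p)   ≡⟨ cong u (+-assoc t p (i * p)) ⟩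
    u (t + (p + i * p)) ∎
    where open ≡-Reasoning

  period-congruent : ∀ {u L p} → HasPeriod u L p → ∀ i j {x y} → x < L → y < L →
                     x + i * p ≡ y + j * p → u x ≡ u y
  period-congruent {u} {L} {p} per zero j {x} {y} x<L y<L eq =
    trans (cong u x≡y+jp) (sym (period-multiple per j y (subst (_< L) x≡y+jp x<L)))
    where
      x≡y+jp : x ≡ y + j * p
      x≡y+jp = trans (sym (+-identityʳ x)) eq
  period-congruent per (suc i) zero x<L y<L eq = sym (period-congruent per zero (suc i) y<L x<L (sym eq))
  period-congruent {p = p} per (suc i) (suc j) {x} {y} x<L y<L eq =
    period-congruent per i j x<L y<L
      (+-cancelˡ-≡ p _ _ (trans (x∙yz≈y∙xz p x (i * p)) (trans eq (x∙yz≈y∙xz y p (j * p)))))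

  agree-by-period : ∀ {u v L p} → 1 ≤ p → HasPeriod u L p → HasPeriod v L p → Agree u v p → Agree u v L
  agree-by-period {u} {v} {L} {p} p≥1 per-u per-v (agreeing uv) = agreeing agree
    where
      instance _ = >-nonZero p≥1
      agree : ∀ t → t < L → u t ≡ v t
      agree t t<L = begin
        u t       ≡⟨ period-congruent per-u 0 (t / p) t<L r<L t≡r+qp ⟩
        u (t % p) ≡⟨ uv (t % p) (m%n<n t p) ⟩
        v (t % p) ≡⟨ period-congruent per-v 0 (t / p) t<L r<L t≡r+qp ⟨
        v t       ∎
        where
          open ≡-Reasoning
          r<L : t % p < L
          r<L = ≤-<-trans (m%n≤m t p) t<L
          t≡r+qp : t + 0 ≡ t % p + t / p * p
          t≡r+qp = trans (+-identityʳ t) (m≡m%n+[m/n]*n t p)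

  -- Positions are moved by multiples of P into the window [a, a + P), where g is a period.
  period-extend : ∀ {u L P g} a {M} → 1 ≤ P → HasPeriod u L P → a + M ≤ L → P + g ≤ M →
                  HasPeriod (u ↓ a) M g → HasPeriod u L g
  period-extend {u} {L} {P} {g} a {M} P≥1 per-P a+M≤L P+g≤M (periodic per-g) = periodic extended
    where
      instance _ = >-nonZero P≥1
      extended : ∀ t → t + g < L → u t ≡ u (t + g)
      extended t t+g<L = begin
        u t               ≡⟨ period-congruent per-P a q t<L t′<L t~t′ ⟩
        u (a + r)         ≡⟨ per-g r r+g<M ⟩
        u (a + (r + g))   ≡⟨ cong u (+-assoc a r g) ⟨
        u (a + r + g)     ≡⟨ period-congruent per-P q a t′+g<L t+g<L t′+g~t+g ⟩
        u (t + g)         ∎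
        where
          open ≡-Reasoning
          x r q : ℕ
          x = t + a * P ∸ a
          r = x % P
          q = x / P
          t~t′ : t + a * P ≡ a + r + q * P
          t~t′ = begin
            t + a * P       ≡⟨ m+[n∸m]≡n (≤-trans (m≤m*n a P) (m≤n+m (a * P) t)) ⟨
            a + x           ≡⟨ cong (a +_) (m≡m%n+[m/n]*n x P) ⟩
            a + (r + q * P) ≡⟨ +-assoc a r (q * P) ⟨
            a + r + q * P   ∎
          t′+g~t+g : a + r + g + q * P ≡ t + g + a * P
          t′+g~t+g = trans (xy∙z≈xz∙y (a + r) g (q * P)) (trans (cong (_+ g) (sym t~t′)) (xy∙z≈xz∙y t (a * P) g))
          r+g<M : r + g < M
          r+g<M = <-≤-trans (+-monoˡ-< g (m%n<n x P)) P+g≤M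
          t′+g<L : a + r + g < L
          t′+g<L = <-≤-trans (subst (_< a + M) (sym (+-assoc a r g)) (+-monoʳ-< a r+g<M)) a+M≤L
          t′<L : a + r < L
          t′<L = ≤-<-trans (m≤m+n (a + r) g) t′+g<L
          t<L : t < L
          t<L = ≤-<-trans (m≤m+n t g) t+g<L

  period-difference : ∀ {u L p d} → HasPeriod u L p → HasPeriod u L (p + d) → p + (p + d) ≤ L →
                      HasPeriod u L d
  period-difference {u} {L} {p} {d} (periodic per-p) (periodic per-q) fits = periodic difference
    where
      difference : ∀ t → t + d < L → u t ≡ u (t + d)
      difference t t+d<L with t + (p + d) <? L
      ... | yes t+q<L = begin
        u t             ≡⟨ per-q t t+q<L ⟩
        u (t + (p + d)) ≡⟨ cong u (x∙yz≈xz∙y t p d) ⟩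
        u (t + d + p)   ≡⟨ per-p (t + d) (subst (_< L) (x∙yz≈xz∙y t p d) t+q<L) ⟨
        u (t + d)       ∎
        where open ≡-Reasoning
      ... | no t+q≮L with m≤n⇒∃[o]m+o≡n (+-cancelʳ-≤ (p + d) p t (≤-trans fits (≮⇒≥ t+q≮L)))
      ...   | t′ , refl = begin
        u (p + t′)       ≡⟨ cong u (+-comm p t′) ⟩
        u (t′ + p)       ≡⟨ per-p t′ (≤-<-trans (≤-reflexive (+-comm t′ p)) (≤-<-trans (m≤m+n (p + t′) d) t+d<L)) ⟨
        u t′             ≡⟨ per-q t′ (subst (_< L) t′+q≡t+d t+d<L) ⟩
        u (t′ + (p + d)) ≡⟨ cong u (sym t′+q≡t+d) ⟩
        u (p + t′ + d)   ∎
        where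
          open ≡-Reasoning
          t′+q≡t+d : p + t′ + d ≡ t′ + (p + d)
          t′+q≡t+d = trans (cong (_+ d) (+-comm p t′)) (+-assoc t′ p d)

  fine-wilf : ∀ {u L p q} → 1 ≤ p → 1 ≤ q → p + q ≤ L → HasPeriod u L p → HasPeriod u L q →
              ∃ λ g → 1 ≤ g × g ∣ p × g ∣ q × HasPeriod u L g
  fine-wilf {p = p} {q} = go (<-wellFounded (p + q))
    where
      go : ∀ {u L p q} → Acc _<_ (p + q) → 1 ≤ p → 1 ≤ q → p + q ≤ L →
           HasPeriod u L p → HasPeriod u L q → ∃ λ g → 1 ≤ g × g ∣ p × g ∣ q × HasPeriod u L g
      go {L = L} {p = p} {q} (acc rec) p≥1 q≥1 fits per-p per-q with <-cmp p q
      ... | tri≈ _ refl _ = p , p≥1 , ∣-refl , ∣-refl , per-p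
      ... | tri< p<q _ _ with split-< p<q
      ...   | d , d≥1 , refl with go (rec (m<n+m (p + d) p≥1)) p≥1 d≥1 (≤-trans (m≤n+m (p + d) p) fits)
                                   per-p (period-difference per-p per-q fits)
      ...     | g , g≥1 , g∣p , g∣d , per-g = g , g≥1 , g∣p , ∣m∣n⇒∣m+n g∣p g∣d , per-g
      go {L = L} {p = p} {q} (acc rec) p≥1 q≥1 fits per-p per-q | tri> _ _ q<p with split-< q<p
      ...   | d , d≥1 , refl with go (rec (m<m+n (q + d) q≥1))
                                   q≥1 d≥1 (≤-trans (m≤m+n (q + d) q) fits)
                                   per-q (period-difference per-q per-p (subst (_≤ L) (+-comm (q + d) q) fits))
      ...     | g , g≥1 , g∣q , g∣d , per-g = g , g≥1 , ∣m∣n⇒∣m+n g∣q g∣d , g∣q , per-g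

  last-position-repeats : ∀ {u s L p e} → HasPeriod (u ↓ s) L p → 1 ≤ p → p < L → suc e ≡ s + L →
                          ∃ λ y → y < e × u y ≡ u e
  last-position-repeats {u} {s} {L} {p} {e} (periodic per) p≥1 p<L end with m≤n⇒∃[o]m+o≡n p<L
  ... | t , refl = s + t , subst (s + t <_) (sym e≡) (+-monoʳ-< s (m<m+n t p≥1)) ,
                   trans (per t (s≤s (≤-reflexive (+-comm t p)))) (cong u (sym e≡))
    where
      e≡ : e ≡ s + (t + p)
      e≡ = suc-injective (trans end (trans (+-suc s (p + t)) (cong (λ x → suc (s + x)) (+-comm p t))))

  -- Leftmost occurrences of powers

  Leftmost : (ℕ → X) → ℕ → ℕ → Set
  Leftmost u s L = ∀ {s′} → s′ < s → ¬ Agree (u ↓ s′) (u ↓ s) L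

  record LeftmostPower (u : ℕ → X) (s L p : ℕ) : Set where
    field
      root-positive : 1 ≤ p
      cube-≤        : 3 * p ≤ L
      root-∣        : p ∣ L
      period        : HasPeriod (u ↓ s) L p
      leftmost      : Leftmost u s L

  period⇒agree-shift : ∀ {u s g z L} → HasPeriod (u ↓ s) (L + (g + z)) g →
                       Agree (u ↓ (s + z)) (u ↓ (s + (g + z))) L
  period⇒agree-shift {u} {s} {g} {z} {L} (periodic per) = agreeing λ t t<L → begin
    u (s + z + t)       ≡⟨ cong u (+-assoc s z t) ⟩
    u (s + (z + t))     ≡⟨ per (z + t) (subst (_< L + (g + z)) (sym (xy∙z≈y∙zx z t g)) (+-monoˡ-< (g + z) t<L)) ⟩
    u (s + (z + t + g)) ≡⟨ cong (λ x → u (s + x)) (xy∙z≈zx∙y z t g) ⟩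
    u (s + (g + z + t)) ≡⟨ cong u (+-assoc s (g + z) t) ⟨
    u (s + (g + z) + t) ∎
    where open ≡-Reasoning

  period-left⇒¬leftmost : ∀ {u s d g L} → Leftmost u (s + d) L → HasPeriod (u ↓ s) (L + d) g →
                           1 ≤ g → g ≤ d → ⊥
  period-left⇒¬leftmost {u} {s} lm per g≥1 g≤d with m≤n⇒∃[o]m+o≡n g≤d
  ... | z , refl = lm (+-monoʳ-< s (m<n+m z g≥1)) (period⇒agree-shift {u} {s} per)

  -- If the root q′ of the longer power is at most the offset d, shifting by q′ moves the shorter
  -- one to the left; otherwise Fine–Wilf gives a common period g, which divides d.
  leftmost-power-¬proper-suffix : ∀ {u s d L q q′} → 1 ≤ d →
    LeftmostPower u (s + d) L q → LeftmostPower u s (L + d) q′ → ⊥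
  leftmost-power-¬proper-suffix {u} {s} {d} {L} {q} {q′} d≥1 X Y =
    [ shift-by-root , shift-by-common-period ]′ (≤-<-connex q′ d)
    where
      module X = LeftmostPower X
      module Y = LeftmostPower Y
      shift-by-root : q′ ≤ d → ⊥
      shift-by-root = period-left⇒¬leftmost {u} X.leftmost Y.period Y.root-positive
      fits : d < q′ → q + q′ ≤ L
      fits = two-roots-fit X.cube-≤ Y.cube-≤
      window : HasPeriod (u ↓ (s + d)) L q′
      window = period-transport (↓-↓ u s d L) (period-↓ d (≤-reflexive (+-comm d L)) Y.period)
      shift-by-common-period : d < q′ → ⊥
      shift-by-common-period d<q′
        with g , g≥1 , g∣q , g∣q′ , per-g ← fine-wilf X.root-positive Y.root-positive (fits d<q′) X.period window =
        period-left⇒¬leftmost {u} X.leftmost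
          (period-extend d Y.root-positive Y.period (≤-reflexive (+-comm d L)) q′+g≤L
            (period-transport (agree-sym (↓-↓ u s d L)) per-g))
          g≥1 (∣⇒≤ g∣d)
        where
          instance
            _ = >-nonZero d≥1
            _ = >-nonZero X.root-positive
          g∣d : g ∣ d
          g∣d = ∣m+n∣m⇒∣n (∣-trans g∣q′ Y.root-∣) (∣-trans g∣q X.root-∣)
          q′+g≤L : q′ + g ≤ L
          q′+g≤L = ≤-trans (+-monoʳ-≤ q′ (∣⇒≤ g∣q)) (subst (_≤ L) (+-comm q q′) (fits d<q′))

  leftmost-power-¬shorter-same-end : ∀ {u s L q s′ L′ q′} → LeftmostPower u s L q → LeftmostPower u s′ L′ q′ →
                                     s + L ≡ s′ + L′ → L < L′ → ⊥
  leftmost-power-¬shorter-same-end {u} {s} {L} {q} {s′} X Y end L<L′ with split-< L<L′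
  ... | d , d≥1 , refl = leftmost-power-¬proper-suffix d≥1 (subst (λ x → LeftmostPower u x L q) s≡s′+d X) Y
    where
      s≡s′+d : s ≡ s′ + d
      s≡s′+d = +-cancelʳ-≡ L s (s′ + d) (trans end (trans (cong (s′ +_) (+-comm L d)) (sym (+-assoc s′ d L))))

  leftmost-powers-same-end : ∀ {u s L q s′ L′ q′} → LeftmostPower u s L q → LeftmostPower u s′ L′ q′ →
                             s + L ≡ s′ + L′ → L ≡ L′
  leftmost-powers-same-end {L = L} {L′ = L′} X Y end with <-cmp L L′
  ... | tri< L<L′ _ _ = ⊥-elim (leftmost-power-¬shorter-same-end X Y end L<L′)
  ... | tri≈ _ L≡L′ _ = L≡L′
  ... | tri> _ _ L′<L = ⊥-elim (leftmost-power-¬shorter-same-end Y X (sym end) L′<L)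

-- Decidable periods and primitive roots

module _ {X : Set} where

  Comparable : (ℕ → X) → Set
  Comparable u = ∀ x y → Dec (u x ≡ u y)

  comparable-↓ : ∀ {u} → Comparable u → ∀ a → Comparable (u ↓ a)
  comparable-↓ compare a x y = compare (a + x) (a + y)

  hasPeriod? : ∀ {u} → Comparable u → ∀ L p → Dec (HasPeriod u L p)
  hasPeriod? {u} compare L p = map′ bounded unbounded (allUpTo? (λ t → (t + p <? L) →-dec compare t (t + p)) L)
    where
      bounded : (∀ {t} → t < L → t + p < L → u t ≡ u (t + p)) → HasPeriod u L p
      bounded h = periodic λ t t+p<L → h (≤-<-trans (m≤m+n t p) t+p<L) t+p<L
      unbounded : HasPeriod u L p → ∀ {t} → t < L → t + p < L → u t ≡ u (t + p)
      unbounded (periodic h) _ = h _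

  agree? : ∀ {u} → Comparable u → ∀ a b L → Dec (Agree (u ↓ a) (u ↓ b) L)
  agree? compare a b L = map′ (λ h → agreeing λ t → h {t}) (λ (agreeing h) {t} → h t)
                           (allUpTo? (λ t → compare (a + t) (b + t)) L)

  leftmost-occurrence : ∀ {u} → Comparable u → ∀ s L →
                        ∃ λ s₀ → s₀ ≤ s × Agree (u ↓ s₀) (u ↓ s) L × Leftmost u s₀ L
  leftmost-occurrence {u} compare s L
    with s₀ , s₀≤s , agrees , minimal ← least (λ x → agree? compare x s L) (agree-refl {u = u ↓ s} {L}) =
    s₀ , s₀≤s , agrees , λ s′<s₀ agrees′ → minimal s′<s₀ (agree-trans agrees′ agrees)

  record PrimitiveRoot (u : ℕ → X) (K U p : ℕ) : Set where
    field
      positive : 1 ≤ p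
      divides-U : p ∣ U
      period : HasPeriod u K p
      minimal : ∀ {q} → 1 ≤ q → q < p → q ∣ U → ¬ HasPeriod u K q

  primitive-root : ∀ {u K U} → Comparable u → 1 ≤ U → HasPeriod u K U → ∃ (PrimitiveRoot u K U)
  primitive-root {u} {K} {U} compare U≥1 per
    with p , _ , (p≥1 , p∣U , per-p) , minimal
           ← least (λ q → (1 ≤? q) ×-dec (q ∣? U) ×-dec hasPeriod? compare K q) (U≥1 , ∣-refl , per) =
    p , record { positive = p≥1 ; divides-U = p∣U ; period = per-p
               ; minimal = λ q≥1 q<p q∣U per-q → minimal q<p (q≥1 , q∣U , per-q) }

  divisor-period⇒≡root : ∀ {u K U p Z g} → PrimitiveRoot u K U p → Z ≤ K → p + g ≤ Z →
                          HasPeriod u Z g → 1 ≤ g → g ∣ p → g ≡ p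
  divisor-period⇒≡root R Z≤K p+g≤Z per-g g≥1 g∣p = ≤-antisym (∣⇒≤ g∣p) (≮⇒≥ g≮p)
    where
      module R = PrimitiveRoot R
      instance _ = >-nonZero R.positive
      g≮p : ¬ _ < _
      g≮p g<p = R.minimal g≥1 g<p (∣-trans g∣p R.divides-U) (period-extend 0 R.positive R.period Z≤K p+g≤Z per-g)

  primitive-roots-agree : ∀ {u v K K′ U U′ p p′ Z} → PrimitiveRoot u K U p → PrimitiveRoot v K′ U′ p′ →
                          Agree u v Z → Z ≤ K → Z ≤ K′ → 3 * p ≤ Z → 3 * p′ ≤ Z → p ≡ p′
  primitive-roots-agree {p = p} {p′} {Z} R R′ uv Z≤K Z≤K′ 3p≤Z 3p′≤Z =
    via (fine-wilf R.positive R′.positive p+p′≤Z (period-prefix Z≤K R.period) per-p′)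
    where
      module R = PrimitiveRoot R
      module R′ = PrimitiveRoot R′
      instance
        _ = >-nonZero R.positive
        _ = >-nonZero R′.positive
      per-p′ : HasPeriod _ Z p′
      per-p′ = period-transport (agree-sym uv) (period-prefix Z≤K′ R′.period)
      p+p′≤Z : p + p′ ≤ Z
      p+p′≤Z = two-roots-fit {d = 0} 3p≤Z (subst (3 * p′ ≤_) (sym (+-identityʳ Z)) 3p′≤Z) R′.positive
      via : (∃ λ g → 1 ≤ g × g ∣ p × g ∣ p′ × HasPeriod _ Z g) → p ≡ p′
      via (g , g≥1 , g∣p , g∣p′ , per-g) = trans (sym g≡p) g≡p′
        where
          g≡p : g ≡ p
          g≡p = divisor-period⇒≡root R Z≤K (≤-trans (+-monoʳ-≤ p (∣⇒≤ g∣p′)) p+p′≤Z) per-g g≥1 g∣p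
          g≡p′ : g ≡ p′
          g≡p′ = divisor-period⇒≡root R′ Z≤K′ (≤-trans (+-monoʳ-≤ p′ (∣⇒≤ g∣p)) (subst (_≤ Z) (+-comm p p′) p+p′≤Z))
                   (period-transport uv per-g) g≥1 g∣p′

-- Images of a power occurrence

module PowerImages {X : Set} (c : ℕ → X) (compare : Comparable c) (k′ : ℕ) where

  k : ℕ
  k = 3 + k′

  -- The exponents mk + 3, …, (m + 1)k (for f = 0, …, k − 3) of the primitive root p of u^k, |u| = (m + 1)|p|.
  exponent : ℕ → ℕ → ℕ
  exponent f m = 3 + f + m * k

  digit-< : ∀ {f} → f ≤ k′ → f < k
  digit-< f≤k′ = ≤-trans (s≤s f≤k′) (m≤n+m (suc k′) 2)

  exponent-fits : ∀ f m p → f ≤ k′ → exponent f m * p ≤ k * (suc m * p)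
  exponent-fits f m p f≤k′ = ≤-trans (*-monoˡ-≤ p (+-monoˡ-≤ (m * k) (+-monoʳ-≤ 3 f≤k′)))
                                         (≤-reflexive (trans (cong (_* p) (*-comm (suc m) k)) (*-assoc k (suc m) p)))

  cube-≤-exponent : ∀ f m p → 3 * p ≤ exponent f m * p
  cube-≤-exponent f m p = *-monoˡ-≤ p (s≤s (s≤s (s≤s (z≤n {f + m * k}))))

  record Image (s U f p m e : ℕ) : Set where
    field
      root       : PrimitiveRoot (c ↓ s) (k * U) U p
      U≡         : U ≡ suc m * p
      start      : ℕ
      occurrence : LeftmostPower c start (exponent f m * p) p
      agrees     : Agree (c ↓ start) (c ↓ s) (exponent f m * p)
      ends-at    : suc e ≡ start + exponent f m * p

  image-of-root : ∀ {s U f p m} → PrimitiveRoot (c ↓ s) (k * U) U p → U ≡ suc m * p → f ≤ k′ →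
                  ∃ λ e → Image s U f p m e × e < s + k * U
  image-of-root {s} {U} {f} {p} {m} R U≡ f≤k′
    with s₀ , s₀≤s , agrees , leftmost ← leftmost-occurrence compare s (exponent f m * p) =
    pred (s₀ + Z) ,
    record { root = R ; U≡ = U≡ ; start = s₀ ; occurrence = occurrence ; agrees = agrees
           ; ends-at = suc-pred (s₀ + Z) } ,
    ≤-trans (≤-reflexive (suc-pred (s₀ + Z))) (+-mono-≤ s₀≤s Z≤kU)
    where
      module R = PrimitiveRoot R
      Z : ℕ
      Z = exponent f m * p
      Z≤kU : Z ≤ k * U
      Z≤kU = subst (λ x → Z ≤ k * x) (sym U≡) (exponent-fits f m p f≤k′)
      instance _ = >-nonZero (≤-trans (≤-trans R.positive (m≤m+n p _)) (≤-trans (cube-≤-exponent f m p) (m≤n+m Z s₀)))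
      occurrence : LeftmostPower c s₀ Z p
      occurrence = record
        { root-positive = R.positive ; cube-≤ = cube-≤-exponent f m p ; root-∣ = n∣m*n (exponent f m)
        ; period = period-transport (agree-sym agrees) (period-prefix Z≤kU R.period) ; leftmost = leftmost }

  image : ∀ {s U f} → 1 ≤ U → HasPeriod (c ↓ s) (k * U) U → f ≤ k′ →
          ∃₂ λ p m → ∃ λ e → Image s U f p m e × e < s + k * U
  image {s} U≥1 per f≤k′ with p , R ← primitive-root (comparable-↓ compare s) U≥1 per with PrimitiveRoot.divides-U R
  ... | divides zero    U≡0 = contradiction (subst (1 ≤_) U≡0 U≥1) λ ()
  ... | divides (suc m) U≡  = p , m , image-of-root R U≡ f≤k′

  image-repeats : ∀ {s U f p m e} → Image s U f p m e → ∃ λ y → y < e × c y ≡ c e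
  image-repeats {f = f} {p} {m} I =
    last-position-repeats occurrence.period occurrence.root-positive
      (<-≤-trans (m<m+n p (≤-trans occurrence.root-positive (m≤m+n p _))) occurrence.cube-≤) ends-at
    where
      open Image I
      module occurrence = LeftmostPower occurrence

  images-same-window : ∀ {s U f p m s′ U′ f′ p′ m′ e} → Image s U f p m e → Image s′ U′ f′ p′ m′ e →
                       exponent f m * p ≡ exponent f′ m′ * p′ × Agree (c ↓ s) (c ↓ s′) (exponent f m * p)
  images-same-window {f = f} {p} {m} {s′} {f′ = f′} {p′} {m′} I I′ =
    Z≡Z′ ,
    agree-trans (agree-sym I.agrees) (subst₂ (λ a L → Agree (c ↓ a) (c ↓ s′) L) (sym start≡) (sym Z≡Z′) I′.agrees)
    where
      module I = Image I
      module I′ = Image I′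
      Z≡Z′ : exponent f m * p ≡ exponent f′ m′ * p′
      Z≡Z′ = leftmost-powers-same-end I.occurrence I′.occurrence (trans (sym I.ends-at) I′.ends-at)
      start≡ : I.start ≡ I′.start
      start≡ = +-cancelʳ-≡ _ I.start I′.start
                 (trans (trans (sym I.ends-at) I′.ends-at) (cong (I′.start +_) (sym Z≡Z′)))

  window-fits : ∀ {s U f p m e} → f ≤ k′ → Image s U f p m e → exponent f m * p ≤ k * U
  window-fits {f = f} {p} {m} f≤k′ I =
    subst (λ x → exponent f m * p ≤ k * x) (sym (Image.U≡ I)) (exponent-fits f m p f≤k′)

  image-injective : ∀ {s U f p m s′ U′ f′ p′ m′ e} → f ≤ k′ → f′ ≤ k′ →
                    Image s U f p m e → Image s′ U′ f′ p′ m′ e →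
                    f ≡ f′ × U ≡ U′ × Agree (c ↓ s) (c ↓ s′) (k * U)
  image-injective {s} {U} {f} {p} {m} {s′} {U′} {f′} {p′} {m′} f≤k′ f′≤k′ I I′ =
    f≡f′ , U≡U′ ,
    agree-by-period R.positive R.period
      (subst₂ (λ L q → HasPeriod (c ↓ s′) (k * L) q) (sym U≡U′) (sym p≡p′) R′.period)
      (agree-prefix (≤-trans (m≤m+n p _) (cube-≤-exponent f m p)) agreeZ)
    where
      module R = PrimitiveRoot (Image.root I)
      module R′ = PrimitiveRoot (Image.root I′)
      window : exponent f m * p ≡ exponent f′ m′ * p′ × Agree (c ↓ s) (c ↓ s′) (exponent f m * p)
      window = images-same-window I I′
      Z≡Z′ : exponent f m * p ≡ exponent f′ m′ * p′
      Z≡Z′ = proj₁ window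
      agreeZ : Agree (c ↓ s) (c ↓ s′) (exponent f m * p)
      agreeZ = proj₂ window
      p≡p′ : p ≡ p′
      p≡p′ = primitive-roots-agree (Image.root I) (Image.root I′) agreeZ (window-fits f≤k′ I)
               (subst (_≤ k * U′) (sym Z≡Z′) (window-fits f′≤k′ I′))
               (cube-≤-exponent f m p) (subst (3 * p′ ≤_) (sym Z≡Z′) (cube-≤-exponent f′ m′ p′))
      digits : f ≡ f′ × m ≡ m′
      digits = division-unique {k} {f} {f′} {m} {m′} (digit-< f≤k′) (digit-< f′≤k′)
                 (+-cancelˡ-≡ 3 _ _ (*-cancelʳ-≡ (exponent f m) (exponent f′ m′) p {{>-nonZero R.positive}}
                   (trans Z≡Z′ (cong (exponent f′ m′ *_) (sym p≡p′)))))
      f≡f′ : f ≡ f′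
      f≡f′ = proj₁ digits
      U≡U′ : U ≡ U′
      U≡U′ = trans (Image.U≡ I) (trans (cong₂ (λ m p → suc m * p) (proj₂ digits) p≡p′) (sym (Image.U≡ I′)))

injection-count : ∀ {a b c n} (f : (Fin a × Fin b) ⊎ Fin c → ℕ) → (∀ z → f z < n) →
                  (∀ {z z′} → f z ≡ f z′ → z ≡ z′) → a * b + c ≤ n
injection-count {a} {b} {c} f f<n f-injective = injective⇒≤ g-injective
  where
    ι : Fin (a * b + c) ↣ ((Fin a × Fin b) ⊎ Fin c)
    ι = ↔⇒↣ ((*↔× ⊎-↔ ↔-id _) ↔-∘ +↔⊎)
    g : Fin (a * b + c) → Fin _
    g i = fromℕ< (f<n (Injection.to ι i))
    g-injective : ∀ {i j} → g i ≡ g j → i ≡ j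
    g-injective {i} {j} gi≡gj = Injection.injective ι (f-injective
      (trans (sym (toℕ-fromℕ< (f<n _))) (trans (cong toℕ gi≡gj) (toℕ-fromℕ< (f<n _)))))

-- Words as sequences

module _ {A : Set} where

  at : List A → ℕ → Maybe A
  at []       _       = nothing
  at (x ∷ xs) zero    = just x
  at (x ∷ xs) (suc t) = at xs t

  at-++ʳ : ∀ xs {ys} t → at (xs ++ ys) (length xs + t) ≡ at ys t
  at-++ʳ []       t = refl
  at-++ʳ (x ∷ xs) t = at-++ʳ xs t

  at-++ˡ : ∀ xs {ys t} → t < length xs → at (xs ++ ys) t ≡ at xs t
  at-++ˡ (x ∷ xs) {t = zero}  _        = refl
  at-++ˡ (x ∷ xs) {t = suc t} (s≤s lt) = at-++ˡ xs lt

  at-∈ : ∀ {xs t a} → at xs t ≡ just a → a ∈ xs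
  at-∈ {x ∷ xs} {zero}  refl = here refl
  at-∈ {x ∷ xs} {suc t} eq   = there (at-∈ {xs} eq)

  at-< : ∀ {xs t a} → at xs t ≡ just a → t < length xs
  at-< {x ∷ xs} {zero}  _  = s≤s z≤n
  at-< {x ∷ xs} {suc t} eq = s≤s (at-< {xs} eq)

  ∈⇒at : ∀ {xs a} → a ∈ xs → ∃ λ t → at xs t ≡ just a
  ∈⇒at (here refl) = zero , refl
  ∈⇒at (there a∈)  with t , eq ← ∈⇒at a∈ = suc t , eq

  at-injective : ∀ {xs ys} → length xs ≡ length ys → Agree (at xs) (at ys) (length xs) → xs ≡ ys
  at-injective {[]}     {[]}     _  _              = refl
  at-injective {x ∷ xs} {y ∷ ys} eq (agreeing same) with refl ← same 0 (s≤s z≤n) =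
    cong (x ∷_) (at-injective (suc-injective eq) (agreeing λ t lt → same (suc t) (s≤s lt)))

  lookup-injective : ∀ {xs : List A} → Unique xs → ∀ {i j} → lookup xs i ≡ lookup xs j → i ≡ j
  lookup-injective {x ∷ xs} _          {zero}  {zero}  _  = refl
  lookup-injective {x ∷ xs} (x∉ ∷ _)   {zero}  {suc j} eq = ⊥-elim (All.lookup x∉ (∈-lookup j) eq)
  lookup-injective {x ∷ xs} (x∉ ∷ _)   {suc i} {zero}  eq = ⊥-elim (All.lookup x∉ (∈-lookup i) (sym eq))
  lookup-injective {x ∷ xs} (_ ∷ uniq) {suc i} {suc j} eq = cong suc (lookup-injective uniq eq)

  module _ {As : List A} (uniq : Unique As) where

    ≟-∈ : ∀ {a b} → a ∈ As → b ∈ As → Dec (a ≡ b)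
    ≟-∈ a∈ b∈ = map′ (λ eq → trans (lookup-index a∈) (trans (cong (lookup As) eq) (sym (lookup-index b∈))))
                     (λ { refl → lookup-injective uniq (trans (sym (lookup-index a∈)) (lookup-index b∈)) })
                     (index a∈ ≟ᶠ index b∈)

    -- A has no decidable equality: letters of w are compared through their indices in As.
    at-comparable : ∀ {w} → (∀ {a} → a ∈ w → a ∈ As) → Comparable (at w)
    at-comparable {w} w⊆As x y with at w x in ex | at w y in ey
    ... | nothing | nothing = yes refl
    ... | nothing | just _  = no λ ()
    ... | just _  | nothing = no λ ()
    ... | just a  | just b  = map′ (cong just) just-injective (≟-∈ (w⊆As (at-∈ ex)) (w⊆As (at-∈ ey)))

  ^ʷ-length : ∀ (u : List A) k → length (u ^ʷ k) ≡ k * length u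
  ^ʷ-length u zero    = refl
  ^ʷ-length u (suc k) = trans (length-++ u) (cong (length u +_) (^ʷ-length u k))

  []^ʷ : ∀ k → [] ^ʷ k ≡ ([] {A = A})
  []^ʷ zero    = refl
  []^ʷ (suc k) = []^ʷ k

  ^ʷ-suc : ∀ (u : List A) k → u ^ʷ suc k ≡ u ^ʷ k ++ u
  ^ʷ-suc u zero    = ++-identityʳ u
  ^ʷ-suc u (suc k) = trans (cong (u ++_) (^ʷ-suc u k)) (sym (++-assoc u (u ^ʷ k) u))

  ^ʷ-period : ∀ (u : List A) k → HasPeriod (at (u ^ʷ k)) (length (u ^ʷ k)) (length u)
  ^ʷ-period u zero    = periodic λ _ ()
  ^ʷ-period u (suc k) = periodic shifted
    where
      shifted : ∀ t → t + length u < length (u ^ʷ suc k) → at (u ^ʷ suc k) t ≡ at (u ^ʷ suc k) (t + length u)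
      shifted t lt = begin
        at (u ^ʷ suc k) t              ≡⟨ cong (λ v → at v t) (^ʷ-suc u k) ⟩
        at (u ^ʷ k ++ u) t             ≡⟨ at-++ˡ (u ^ʷ k) t<|uᵏ| ⟩
        at (u ^ʷ k) t                  ≡⟨ at-++ʳ u t ⟨
        at (u ^ʷ suc k) (length u + t) ≡⟨ cong (at (u ^ʷ suc k)) (+-comm (length u) t) ⟩
        at (u ^ʷ suc k) (t + length u) ∎
        where
          open ≡-Reasoning
          t<|uᵏ| : t < length (u ^ʷ k)
          t<|uᵏ| = +-cancelˡ-< (length u) t _ (subst₂ _<_ (+-comm t (length u)) (length-++ u) lt)

  record PowerOccurrence (k : ℕ) (w y : List A) (s U : ℕ) : Set where
    field
      root-positive : 1 ≤ U
      period        : HasPeriod (at w ↓ s) (k * U) U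
      within        : s + k * U ≤ length w
      length≡       : length y ≡ k * U
      spells        : Agree (at w ↓ s) (at y) (k * U)

  power-factor-occurrence : ∀ {k w y} → NonEmptyPowerFactor k w y → ∃₂ (PowerOccurrence k w y)
  power-factor-occurrence {k} {w} ((P , S , refl) , y≢[] , u , refl) = length P , length u , record
    { root-positive = root-positive u y≢[]
    ; period        = period-transport (agree-sym spells)
                        (subst (λ L → HasPeriod (at (u ^ʷ k)) L (length u)) length≡ (^ʷ-period u k))
    ; within        = ≤-trans (+-monoʳ-≤ (length P) (≤-trans (≤-reflexive (sym length≡)) (length-++-≤ˡ (u ^ʷ k) {S})))
                              (≤-reflexive (sym (length-++ P)))
    ; length≡       = length≡
    ; spells        = spells }
    where
      length≡ : length (u ^ʷ k) ≡ k * length u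
      length≡ = ^ʷ-length u k
      root-positive : ∀ u → ¬ u ^ʷ k ≡ [] → 1 ≤ length u
      root-positive []      ≢[] = ⊥-elim (≢[] ([]^ʷ k))
      root-positive (_ ∷ _) _   = s≤s z≤n
      spells : Agree (at (P ++ u ^ʷ k ++ S) ↓ length P) (at (u ^ʷ k)) (k * length u)
      spells = agreeing λ t t<kU →
        trans (at-++ʳ P t) (at-++ˡ (u ^ʷ k) (subst (t <_) (sym length≡) t<kU))

  same-occurrence⇒≡ : ∀ {k w y y′ s s′ U U′} → PowerOccurrence k w y s U → PowerOccurrence k w y′ s′ U′ →
                      U ≡ U′ → Agree (at w ↓ s) (at w ↓ s′) (k * U) → y ≡ y′
  same-occurrence⇒≡ O O′ refl agrees =
    at-injective (trans O.length≡ (sym O′.length≡))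
      (subst (Agree _ _) (sym O.length≡) (agree-trans (agree-sym O.spells) (agree-trans agrees O′.spells)))
    where
      module O = PowerOccurrence O
      module O′ = PowerOccurrence O′

module Counting {A : Set} (k′ : ℕ) (w : List A)
                {Ls : List (List A)} (Ls-enum : Enumerates Ls (NonEmptyPowerFactor (3 + k′) w))
                {As : List A} (As-enum : Enumerates As (InAlph w)) where

  compare : Comparable (at w)
  compare = at-comparable (proj₁ As-enum) (Equivalence.from (proj₂ As-enum _))

  open PowerImages (at w) compare k′

  record FactorImage (f : Fin (suc k′)) (i : Fin (length Ls)) (e : ℕ) : Set where
    field
      {s U p m}  : ℕ
      occurrence : PowerOccurrence k w (lookup Ls i) s U
      marks      : Image s U (toℕ f) p m e

  factor-image : ∀ f i → ∃ λ e → FactorImage f i e × e < length w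
  factor-image f i
    with s , U , O ← power-factor-occurrence (Equivalence.to (proj₂ Ls-enum _) (∈-lookup i))
    with p , m , e , I , e<end ← image (PowerOccurrence.root-positive O) (PowerOccurrence.period O) (s≤s⁻¹ (toℕ<n f))
    = e , record { occurrence = O ; marks = I } , <-≤-trans e<end (PowerOccurrence.within O)

  factor-image-injective : ∀ {f i f′ i′ e} → FactorImage f i e → FactorImage f′ i′ e → f ≡ f′ × i ≡ i′
  factor-image-injective {f} {i} {f′} {i′} J J′ =
    let f≡f′ , U≡U′ , agrees = image-injective (s≤s⁻¹ (toℕ<n f)) (s≤s⁻¹ (toℕ<n f′)) J.marks J′.marks
    in toℕ-injective f≡f′ ,
       lookup-injective (proj₁ Ls-enum) (same-occurrence⇒≡ J.occurrence J′.occurrence U≡U′ agrees)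
    where
      module J = FactorImage J
      module J′ = FactorImage J′

  FirstOccurrence : Fin (length As) → ℕ → Set
  FirstOccurrence r x = at w x ≡ just (lookup As r) × (∀ {y} → y < x → ¬ at w y ≡ at w x)

  first-occurrence : ∀ r → ∃ λ x → FirstOccurrence r x × x < length w
  first-occurrence r
    with x₀ , spells ← ∈⇒at (Equivalence.to (proj₂ As-enum _) (∈-lookup r))
    with x , _ , x~x₀ , minimal ← least (λ x → compare x x₀) {x₀} refl
    = x , (trans x~x₀ spells , λ y<x y~x → minimal y<x (trans y~x x~x₀)) , at-< {xs = w} (trans x~x₀ spells)

  first-occurrence-injective : ∀ {r r′ x} → FirstOccurrence r x → FirstOccurrence r′ x → r ≡ r′
  first-occurrence-injective (spells , _) (spells′ , _) =
    lookup-injective (proj₁ As-enum) (just-injective (trans (sym spells) spells′))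

  image-¬first : ∀ {f i r e} → FactorImage f i e → ¬ FirstOccurrence r e
  image-¬first J (_ , first) with y , y<e , y~e ← image-repeats (FactorImage.marks J) = first y<e y~e

  Position : Set
  Position = (Fin (suc k′) × Fin (length Ls)) ⊎ Fin (length As)

  position : Position → ℕ
  position (inj₁ (f , i)) = proj₁ (factor-image f i)
  position (inj₂ r)       = proj₁ (first-occurrence r)

  position-< : ∀ z → position z < length w
  position-< (inj₁ (f , i)) = proj₂ (proj₂ (factor-image f i))
  position-< (inj₂ r)       = proj₂ (proj₂ (first-occurrence r))

  image-at : ∀ f i → FactorImage f i (position (inj₁ (f , i)))
  image-at f i = proj₁ (proj₂ (factor-image f i))

  first-at : ∀ r → FirstOccurrence r (position (inj₂ r))
  first-at r = proj₁ (proj₂ (first-occurrence r))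

  position-injective : ∀ {z z′} → position z ≡ position z′ → z ≡ z′
  position-injective {inj₁ (f , i)} {inj₁ (f′ , i′)} eq =
    cong inj₁ (uncurry (cong₂ _,_)
      (factor-image-injective (image-at f i) (subst (FactorImage f′ i′) (sym eq) (image-at f′ i′))))
  position-injective {inj₁ (f , i)} {inj₂ r}         eq =
    ⊥-elim (image-¬first (image-at f i) (subst (FirstOccurrence r) (sym eq) (first-at r)))
  position-injective {inj₂ r}       {inj₁ (f , i)}   eq =
    ⊥-elim (image-¬first (image-at f i) (subst (FirstOccurrence r) eq (first-at r)))
  position-injective {inj₂ r}       {inj₂ r′}        eq =
    cong inj₂ (first-occurrence-injective (first-at r) (subst (FirstOccurrence r′) (sym eq) (first-at r′)))

theorem1p1 : {A : Set} (k : ℕ) → 2 < k → (w : List A)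
    → (Ls : List (List A)) → Enumerates Ls (NonEmptyPowerFactor k w)
    → (As : List A) → Enumerates As (InAlph w)
    → (k ∸ 2) * length Ls ≤ length w ∸ length As
theorem1p1 (suc zero)          (s≤s ())
theorem1p1 (suc (suc zero))    (s≤s (s≤s ()))
theorem1p1 (suc (suc (suc k′))) _ w Ls Ls-enum As As-enum =
  m+n≤o⇒m≤o∸n (suc k′ * length Ls) (injection-count position position-< position-injective)
  where open Counting k′ w Ls-enum As-enum
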